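{- For every $n\ge0$, \[ \phi_n(x)=(x-1)\cdot U^{\mathrm{e}}_n(x)\cdot S_n(x), \] where $\phi_n(x)=((n+1)x^2-3x-n)U_n(x)+(x+1)(U_{n-1}(x)+1)$, $S_{2n}(x)=(2nx+x+2n-1)U_n(x)-(2nx+3x+2n+1)U_{n-1}(x)$ and $S_{2n+1}(x)=2(2nx^2+2x^2+2nx-x-1)U_n(x)-2(2nx+3x+2n+1)U_{n-1}(x)$.
   Context: $U_m(x)$ is the Chebyshev polynomial of the second kind, $U_m(\cos\theta)=\sin((m+1)\theta)/\sin\theta$, with $U_{ -1}(x)=0$. The partial Chebyshev polynomial $U^{\mathrm{e}}_n$ is defined, with $x=\cos\theta$, by $U^{\mathrm{e}}_n(x)=\dfrac{\sin((n+1)\theta/2)}{\sin(\theta/2)}$ if $n$ is even and $U^{\mathrm{e}}_n(x)=\dfrac{\sin((n+1)\theta/2)}{\sin\theta}$ if $n$ is odd (equivalently $U^{\mathrm{e}}_{2m}=U_m+U_{m-1}$, $U^{\mathrm{e}}_{2m+1}=U_m$). -}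

module Defs where

open import Level using (Level)
open import Data.Nat using (ℕ; zero; suc) renaming (_*_ to _*ℕ_)
open import Algebra.Bundles using (CommutativeRing)

-- A polynomial identity in ℤ[x] holds iff it
-- holds for every commutative ring R and every x ∈ R (take R = ℤ[x]).
module Cheb {c ℓ : Level} (R : CommutativeRing c ℓ) (x : CommutativeRing.Carrier R) where
  open CommutativeRing R hiding (zero)

  fromℕ : ℕ → Carrier
  fromℕ zero    = 0#
  fromℕ (suc n) = 1# + fromℕ n

  U : ℕ → Carrier
  U zero          = 1#
  U (suc zero)    = x + x
  U (suc (suc n)) = (x + x) * U (suc n) - U n

  -- V n = U_{n-1}(x), with U_{-1} = 0
  V : ℕ → Carrier
  V zero    = 0#
  V (suc n) = U n

  halfCase : ℕ → (ℕ → Carrier) → (ℕ → Carrier) → Carrier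
  halfCase zero          e o = e zero
  halfCase (suc zero)    e o = o zero
  halfCase (suc (suc n)) e o = halfCase n (λ m → e (suc m)) (λ m → o (suc m))

  Ue : ℕ → Carrier
  Ue n = halfCase n (λ m → U m + V m) (λ m → U m)

  φ : ℕ → Carrier
  φ n = (fromℕ (suc n) * (x * x) - fromℕ 3 * x - fromℕ n) * U n
        + (x + 1#) * (V n + 1#)

  Seven : ℕ → Carrier
  Seven m = (fromℕ (2 *ℕ m) * x + x + fromℕ (2 *ℕ m) - 1#) * U m
            - (fromℕ (2 *ℕ m) * x + fromℕ 3 * x + fromℕ (2 *ℕ m) + 1#) * V m

  Sodd : ℕ → Carrier
  Sodd m = fromℕ 2 * (fromℕ (2 *ℕ m) * (x * x) + fromℕ 2 * (x * x)
                      + fromℕ (2 *ℕ m) * x - x - 1#) * U m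
           - fromℕ 2 * (fromℕ (2 *ℕ m) * x + fromℕ 3 * x + fromℕ (2 *ℕ m) + 1#) * V m

  S : ℕ → Carrier
  S n = halfCase n Seven Sodd

{-# OPTIONS --safe #-}
-- Write a = U_m and b = U_{m-1}. The doubling formulas U_{2m} = a² - b², U_{2m+1} = a(2xa - 2b) and
-- U_{2m-1} = b(2a - 2xb) turn φ_{2m} and φ_{2m+1} into polynomials in x, n, a and b, and each differs
-- from the claimed product (x - 1) Ue_n S_n by (x + 1)(1 - (a² - 2xab + b²)). That remainder vanishes
-- by the Cassini-type identity a² - 2xab + b² = 1. All identities involved have integer coefficients,
-- so they hold in every commutative ring.
module Submission where

open import Level using (Level)
open import Algebra.Bundles using (CommutativeRing; Ring)
open import Data.Maybe.Base using (Maybe; map)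
open import Data.Nat.Base as ℕ using (ℕ; zero; suc)
import Data.Nat.Properties as ℕ
open import Data.Integer.Base as ℤ using (ℤ; +_; -[1+_])
import Data.Integer.Properties as ℤ
open import Data.Sign.Base as Sign using (Sign)
open import Function.Base using (_∘_)
open import Relation.Binary.Consequences using (dec⇒weaklyDec)
open import Relation.Binary.PropositionalEquality.Core as ≡ using (_≡_)
import Algebra.Solver.Ring.AlmostCommutativeRing as ACR
open import Defs

module ℤ-RingSolver {c ℓ : Level} (R : CommutativeRing c ℓ) where
  open CommutativeRing R
  open import Algebra.Properties.Ring ring
    using (-‿distribˡ-*; -‿distribʳ-*; -‿involutive; -0#≈0#; -‿+-comm; quasigroup)
  open import Algebra.Properties.Quasigroup quasigroup using (x≈z//y)
  open import Algebra.Properties.CommutativeSemigroup +-commutativeSemigroup using (x∙yz≈y∙xz)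
  open import Algebra.Properties.Semiring.Mult.TCOptimised semiring
    using (_×_; 1+×; ×-homo-+; ×1-homo-*)
  open import Relation.Binary.Reasoning.Setoid setoid

  -- The optimised _×_ has 1 × 1# = 1# definitionally, so the solver's constant + 1 evaluates to 1#.
  fromℤ : ℤ → Carrier
  fromℤ (+ n)    = n × 1#
  fromℤ -[1+ n ] = - (suc n × 1#)

  fromℤ-homo-neg : ∀ i → fromℤ (ℤ.- i) ≈ - fromℤ i
  fromℤ-homo-neg (+ zero)  = sym -0#≈0#
  fromℤ-homo-neg (+ suc n) = refl
  fromℤ-homo-neg -[1+ n ]  = sym (-‿involutive _)

  fromℤ-⊖-+ : ∀ m n → fromℤ (m ℤ.⊖ n) + n × 1# ≈ m × 1#
  fromℤ-⊖-+ zero    zero    = +-identityˡ 0#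
  fromℤ-⊖-+ zero    (suc n) = -‿inverseˡ _
  fromℤ-⊖-+ (suc m) zero    = +-identityʳ _
  fromℤ-⊖-+ (suc m) (suc n) = begin
    fromℤ (suc m ℤ.⊖ suc n) + suc n × 1# ≡⟨ ≡.cong (λ i → fromℤ i + _) (ℤ.[1+m]⊖[1+n]≡m⊖n m n) ⟩
    fromℤ (m ℤ.⊖ n) + suc n × 1#         ≈⟨ +-congˡ (1+× n 1#) ⟩
    fromℤ (m ℤ.⊖ n) + (1# + n × 1#)      ≈⟨ x∙yz≈y∙xz _ 1# _ ⟩
    1# + (fromℤ (m ℤ.⊖ n) + n × 1#)      ≈⟨ +-congˡ (fromℤ-⊖-+ m n) ⟩
    1# + m × 1#                          ≈⟨ 1+× m 1# ⟨
    suc m × 1#                           ∎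

  fromℤ-⊖ : ∀ m n → fromℤ (m ℤ.⊖ n) ≈ m × 1# - n × 1#
  fromℤ-⊖ m n = x≈z//y _ _ _ (fromℤ-⊖-+ m n)

  fromℤ-homo-+ : ∀ i j → fromℤ (i ℤ.+ j) ≈ fromℤ i + fromℤ j
  fromℤ-homo-+ (+ m)    (+ n)    = ×-homo-+ 1# m n
  fromℤ-homo-+ (+ m)    -[1+ n ] = fromℤ-⊖ m (suc n)
  fromℤ-homo-+ -[1+ m ] (+ n)    = trans (fromℤ-⊖ n (suc m)) (+-comm _ _)
  fromℤ-homo-+ -[1+ m ] -[1+ n ] = begin
    - (suc (suc (m ℕ.+ n)) × 1#)      ≡⟨ ≡.cong (λ k → - (suc k × 1#)) (ℕ.+-suc m n) ⟨
    - ((suc m ℕ.+ suc n) × 1#)        ≈⟨ -‿cong (×-homo-+ 1# (suc m) (suc n)) ⟩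
    - (suc m × 1# + suc n × 1#)       ≈⟨ -‿+-comm _ _ ⟨
    - (suc m × 1#) + - (suc n × 1#)   ∎

  signed : Sign → Carrier → Carrier
  signed Sign.+ a = a
  signed Sign.- a = - a

  signed-cong : ∀ s {a b} → a ≈ b → signed s a ≈ signed s b
  signed-cong Sign.+ a≈b = a≈b
  signed-cong Sign.- a≈b = -‿cong a≈b

  signed-* : ∀ s t a b → signed (s Sign.* t) (a * b) ≈ signed s a * signed t b
  signed-* Sign.+ Sign.+ a b = refl
  signed-* Sign.+ Sign.- a b = -‿distribʳ-* a b
  signed-* Sign.- Sign.+ a b = -‿distribˡ-* a b
  signed-* Sign.- Sign.- a b = begin
    a * b         ≈⟨ -‿involutive _ ⟨
    - - (a * b)   ≈⟨ -‿cong (-‿distribˡ-* a b) ⟩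
    - (- a * b)   ≈⟨ -‿distribʳ-* (- a) b ⟩
    - a * - b     ∎

  fromℤ-◃ : ∀ s n → fromℤ (s ℤ.◃ n) ≈ signed s (n × 1#)
  fromℤ-◃ Sign.+ zero    = refl
  fromℤ-◃ Sign.- zero    = sym -0#≈0#
  fromℤ-◃ Sign.+ (suc n) = refl
  fromℤ-◃ Sign.- (suc n) = refl

  fromℤ≈signed : ∀ i → fromℤ i ≈ signed (ℤ.sign i) (ℤ.∣ i ∣ × 1#)
  fromℤ≈signed (+ n)    = refl
  fromℤ≈signed -[1+ n ] = refl

  fromℤ-homo-* : ∀ i j → fromℤ (i ℤ.* j) ≈ fromℤ i * fromℤ j
  fromℤ-homo-* i j = begin
    fromℤ (s Sign.* t ℤ.◃ m ℕ.* n)          ≈⟨ fromℤ-◃ (s Sign.* t) (m ℕ.* n) ⟩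
    signed (s Sign.* t) ((m ℕ.* n) × 1#)    ≈⟨ signed-cong (s Sign.* t) (×1-homo-* m n) ⟩
    signed (s Sign.* t) (m × 1# * n × 1#)   ≈⟨ signed-* s t _ _ ⟩
    signed s (m × 1#) * signed t (n × 1#)   ≈⟨ *-cong (fromℤ≈signed i) (fromℤ≈signed j) ⟨
    fromℤ i * fromℤ j                       ∎
    where
    s = ℤ.sign i
    t = ℤ.sign j
    m = ℤ.∣ i ∣
    n = ℤ.∣ j ∣

  fromℤ-morphism : ℤ.+-*-rawRing ACR.-Raw-AlmostCommutative⟶ ACR.fromCommutativeRing R
  fromℤ-morphism = record
    { ⟦_⟧    = fromℤ
    ; +-homo = fromℤ-homo-+
    ; *-homo = fromℤ-homo-*
    ; -‿homo = fromℤ-homo-neg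
    ; 0-homo = refl
    ; 1-homo = refl
    }

  fromℤ-≟ : ∀ i j → Maybe (fromℤ i ≈ fromℤ j)
  fromℤ-≟ i j = map (λ { ≡.refl → refl }) (dec⇒weaklyDec ℤ._≟_ i j)

  open import Algebra.Solver.Ring ℤ.+-*-rawRing (ACR.fromCommutativeRing R) fromℤ-morphism fromℤ-≟ public

module _ {c ℓ : Level} (R : Ring c ℓ) where
  open Ring R
  open import Relation.Binary.Reasoning.Setoid setoid

  x+y*[1-z]≈x : ∀ x y {z} → z ≈ 1# → x + y * (1# - z) ≈ x
  x+y*[1-z]≈x x y {z} z≈1 = begin
    x + y * (1# - z)    ≈⟨ +-congˡ (*-congˡ (+-congˡ (-‿cong z≈1))) ⟩
    x + y * (1# - 1#)   ≈⟨ +-congˡ (*-congˡ (-‿inverseʳ 1#)) ⟩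
    x + y * 0#          ≈⟨ +-congˡ (zeroʳ y) ⟩
    x + 0#              ≈⟨ +-identityʳ x ⟩
    x                   ∎

even-odd-induction : ∀ {p} (P : ℕ → Set p) →
                     (∀ m → P (2 ℕ.* m)) → (∀ m → P (suc (2 ℕ.* m))) → ∀ n → P n
even-odd-induction P even odd zero          = even 0
even-odd-induction P even odd (suc zero)    = odd 0
even-odd-induction P even odd (suc (suc n)) = even-odd-induction (P ∘ suc ∘ suc)
  (λ m → ≡.subst P (ℕ.*-suc 2 m) (even (suc m)))
  (λ m → ≡.subst (P ∘ suc) (ℕ.*-suc 2 m) (odd (suc m)))
  n

module Chebyshev {c ℓ : Level} (R : CommutativeRing c ℓ) (x : CommutativeRing.Carrier R) where
  open CommutativeRing R hiding (zero)
  open Cheb R x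
  open ℤ-RingSolver R
  open import Relation.Binary.Reasoning.Setoid setoid

  -- These evaluate to 1# and 0# on the nose, and k :× 1ₚ to the fromℕ k of Defs.
  1ₚ 0ₚ : ∀ {n} → Polynomial n
  1ₚ = con (+ 1)
  0ₚ = con (+ 0)

  cassini : ∀ m → U m * U m - (x + x) * U m * V m + V m * V m ≈ 1#
  cassini zero          = solve 1 (λ X → 1ₚ :* 1ₚ :- (X :+ X) :* 1ₚ :* 0ₚ :+ 0ₚ :* 0ₚ := 1ₚ) refl x
  cassini (suc zero)    =
    solve 1 (λ X → (X :+ X) :* (X :+ X) :- (X :+ X) :* (X :+ X) :* 1ₚ :+ 1ₚ :* 1ₚ := 1ₚ) refl x
  cassini (suc (suc m)) = trans
    (solve 3 (λ X a b →
                let c = (X :+ X) :* a :- b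
                in c :* c :- (X :+ X) :* c :* a :+ a :* a := a :* a :- (X :+ X) :* a :* b :+ b :* b)
             refl x (U (suc m)) (U m))
    (cassini (suc m))

  U-double     : ∀ m → U (2 ℕ.* m) ≈ U m * U m - V m * V m
  U-double-suc : ∀ m → U (suc (2 ℕ.* m)) ≈ U m * ((x + x) * U m - (V m + V m))

  U-double zero          = solve 1 (λ X → 1ₚ := 1ₚ :* 1ₚ :- 0ₚ :* 0ₚ) refl x
  U-double (suc zero)    =
    solve 1 (λ X → (X :+ X) :* (X :+ X) :- 1ₚ := (X :+ X) :* (X :+ X) :- 1ₚ :* 1ₚ) refl x
  U-double (suc (suc m)) = begin
    U (2 ℕ.* suc (suc m))
      ≡⟨ ≡.cong U (ℕ.*-suc 2 (suc m)) ⟩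
    (x + x) * U (suc (2 ℕ.* suc m)) - U (2 ℕ.* suc m)
      ≈⟨ +-cong (*-congˡ (U-double-suc (suc m))) (-‿cong (U-double (suc m))) ⟩
    (x + x) * (a * ((x + x) * a - (b + b))) - (a * a - b * b)
      ≈⟨ solve 3 (λ X a b →
                    let c = (X :+ X) :* a :- b
                    in (X :+ X) :* (a :* ((X :+ X) :* a :- (b :+ b))) :- (a :* a :- b :* b)
                       := c :* c :- a :* a)
                 refl x a b ⟩
    U (suc (suc m)) * U (suc (suc m)) - a * a
      ∎
    where
    a = U (suc m)
    b = U m

  U-double-suc zero          = solve 1 (λ X → X :+ X := 1ₚ :* ((X :+ X) :* 1ₚ :- (0ₚ :+ 0ₚ))) refl x
  U-double-suc (suc zero)    =
    solve 1 (λ X → (X :+ X) :* ((X :+ X) :* (X :+ X) :- 1ₚ) :- (X :+ X)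
                   := (X :+ X) :* ((X :+ X) :* (X :+ X) :- (1ₚ :+ 1ₚ))) refl x
  U-double-suc (suc (suc m)) = begin
    U (suc (2 ℕ.* suc (suc m)))
      ≡⟨ ≡.cong (U ∘ suc) (ℕ.*-suc 2 (suc m)) ⟩
    (x + x) * ((x + x) * U (suc k) - U k) - U (suc k)
      ≈⟨ +-cong (*-congˡ (+-cong (*-congˡ (U-double-suc (suc m))) (-‿cong (U-double (suc m)))))
                (-‿cong (U-double-suc (suc m))) ⟩
    (x + x) * ((x + x) * p - q) - p
      ≈⟨ solve 3 (λ X a b →
                    let c = (X :+ X) :* a :- b
                        p = a :* ((X :+ X) :* a :- (b :+ b))
                        q = a :* a :- b :* b
                    in (X :+ X) :* ((X :+ X) :* p :- q) :- p := c :* ((X :+ X) :* c :- (a :+ a)))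
                 refl x a b ⟩
    U (suc (suc m)) * ((x + x) * U (suc (suc m)) - (a + a))
      ∎
    where
    a = U (suc m)
    b = U m
    k = 2 ℕ.* suc m
    p = a * ((x + x) * a - (b + b))
    q = a * a - b * b

  V-double : ∀ m → V (2 ℕ.* m) ≈ V m * ((U m + U m) - (x + x) * V m)
  V-double zero          = solve 1 (λ X → 0ₚ := 0ₚ :* ((1ₚ :+ 1ₚ) :- (X :+ X) :* 0ₚ)) refl x
  V-double (suc zero)    =
    solve 1 (λ X → X :+ X := 1ₚ :* (((X :+ X) :+ (X :+ X)) :- (X :+ X) :* 1ₚ)) refl x
  V-double (suc (suc m)) = begin
    V (2 ℕ.* suc (suc m))
      ≡⟨ ≡.cong V (ℕ.*-suc 2 (suc m)) ⟩
    U (suc (2 ℕ.* suc m))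
      ≈⟨ U-double-suc (suc m) ⟩
    a * ((x + x) * a - (b + b))
      ≈⟨ solve 3 (λ X a b →
                    let c = (X :+ X) :* a :- b
                    in a :* ((X :+ X) :* a :- (b :+ b)) := a :* ((c :+ c) :- (X :+ X) :* a))
                 refl x a b ⟩
    a * ((U (suc (suc m)) + U (suc (suc m))) - (x + x) * a)
      ∎
    where
    a = U (suc m)
    b = U m

  -- φ n is definitionally φ′ (fromℕ n) (U n) (V n).
  φ′ : Carrier → Carrier → Carrier → Carrier
  φ′ t u v = ((1# + t) * (x * x) - fromℕ 3 * x - t) * u + (x + 1#) * (v + 1#)

  φ′-cong : ∀ t {u u′ v v′} → u ≈ u′ → v ≈ v′ → φ′ t u v ≈ φ′ t u′ v′
  φ′-cong t u≈u′ v≈v′ = +-cong (*-congˡ u≈u′) (*-congˡ (+-congʳ v≈v′))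

  halfCase-even : ∀ m e o → halfCase (2 ℕ.* m) e o ≡ e m
  halfCase-even zero    e o = ≡.refl
  halfCase-even (suc m) e o = ≡.trans (≡.cong (λ n → halfCase n e o) (ℕ.*-suc 2 m))
                                      (halfCase-even m (e ∘ suc) (o ∘ suc))

  halfCase-odd : ∀ m e o → halfCase (suc (2 ℕ.* m)) e o ≡ o m
  halfCase-odd zero    e o = ≡.refl
  halfCase-odd (suc m) e o = ≡.trans (≡.cong (λ n → halfCase (suc n) e o) (ℕ.*-suc 2 m))
                                     (halfCase-odd m (e ∘ suc) (o ∘ suc))

  φ-even : ∀ m → φ (2 ℕ.* m) ≈ (x - 1#) * Ue (2 ℕ.* m) * S (2 ℕ.* m)
  φ-even m = begin
    φ (2 ℕ.* m)
      ≈⟨ φ′-cong t (U-double m) (V-double m) ⟩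
    φ′ t (a * a - b * b) (b * ((a + a) - (x + x) * b))
      ≈⟨ solve 4 (λ X t a b →
                    ((1ₚ :+ t) :* (X :* X) :- 3 :× 1ₚ :* X :- t) :* (a :* a :- b :* b)
                    :+ (X :+ 1ₚ) :* (b :* ((a :+ a) :- (X :+ X) :* b) :+ 1ₚ)
                    := (X :- 1ₚ) :* (a :+ b)
                         :* ((t :* X :+ X :+ t :- 1ₚ) :* a :- (t :* X :+ 3 :× 1ₚ :* X :+ t :+ 1ₚ) :* b)
                       :+ (X :+ 1ₚ) :* (1ₚ :- (a :* a :- (X :+ X) :* a :* b :+ b :* b)))
                 refl x t a b ⟩
    (x - 1#) * (a + b) * Seven m + (x + 1#) * (1# - (a * a - (x + x) * a * b + b * b))
      ≈⟨ x+y*[1-z]≈x ring _ _ (cassini m) ⟩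
    (x - 1#) * (a + b) * Seven m
      ≡⟨ ≡.cong₂ (λ u s → (x - 1#) * u * s) (halfCase-even m _ _) (halfCase-even m Seven Sodd) ⟨
    (x - 1#) * Ue (2 ℕ.* m) * S (2 ℕ.* m)
      ∎
    where
    t = fromℕ (2 ℕ.* m)
    a = U m
    b = V m

  φ-odd : ∀ m → φ (suc (2 ℕ.* m)) ≈ (x - 1#) * Ue (suc (2 ℕ.* m)) * S (suc (2 ℕ.* m))
  φ-odd m = begin
    φ (suc (2 ℕ.* m))
      ≈⟨ φ′-cong (1# + t) (U-double-suc m) (U-double m) ⟩
    φ′ (1# + t) (a * ((x + x) * a - (b + b))) (a * a - b * b)
      ≈⟨ solve 4 (λ X t a b →
                    ((1ₚ :+ (1ₚ :+ t)) :* (X :* X) :- 3 :× 1ₚ :* X :- (1ₚ :+ t))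
                      :* (a :* ((X :+ X) :* a :- (b :+ b)))
                    :+ (X :+ 1ₚ) :* ((a :* a :- b :* b) :+ 1ₚ)
                    := (X :- 1ₚ) :* a
                         :* (2 :× 1ₚ :* (t :* (X :* X) :+ 2 :× 1ₚ :* (X :* X) :+ t :* X :- X :- 1ₚ) :* a
                             :- 2 :× 1ₚ :* (t :* X :+ 3 :× 1ₚ :* X :+ t :+ 1ₚ) :* b)
                       :+ (X :+ 1ₚ) :* (1ₚ :- (a :* a :- (X :+ X) :* a :* b :+ b :* b)))
                 refl x t a b ⟩
    (x - 1#) * a * Sodd m + (x + 1#) * (1# - (a * a - (x + x) * a * b + b * b))
      ≈⟨ x+y*[1-z]≈x ring _ _ (cassini m) ⟩
    (x - 1#) * a * Sodd m
      ≡⟨ ≡.cong₂ (λ u s → (x - 1#) * u * s) (halfCase-odd m _ _) (halfCase-odd m Seven Sodd) ⟨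
    (x - 1#) * Ue (suc (2 ℕ.* m)) * S (suc (2 ℕ.* m))
      ∎
    where
    t = fromℕ (2 ℕ.* m)
    a = U m
    b = V m

theorem4p1 : {c ℓ : Level} (R : CommutativeRing c ℓ) (x : CommutativeRing.Carrier R) (n : ℕ) →
    let open CommutativeRing R
        open Cheb R x
    in φ n ≈ (x - 1#) * Ue n * S n
theorem4p1 R x = even-odd-induction _ φ-even φ-odd
  where open Chebyshev R x
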